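{- Suppose that $n\in\mathbb{N}$ is a sum of three squares of integers. Then $n$ can be written as $n=x^2+y^2+z^2+w^2$ with $x,y,z,w\in\mathbb{Z}$ and $x+2y+2z=0$.
   Context: $\mathbb{N}=\{0,1,2,\ldots\}$. -}

{-# OPTIONS --safe #-}
module Submission where

-- If u + v = 3s, then u² + v² = (−2s)² + (2s − v)² + (v − s)², and these three
-- numbers x, y, z satisfy x + 2y + 2z = 0.  Up to sign the residues modulo 3 fall
-- into the two classes {0} and {±1}, so among a, b, c two lie in the same class;
-- then their sum or their difference is divisible by 3, and as v² = (−v)² either
-- case gives u, v as above, with the third number as w.

open import Data.Bool using (Bool; true; false)
open import Data.Integer using (ℤ; +_; _+_; _*_; _^_; _-_; -_; _%ℕ_; _/ℕ_)
open import Data.Integer.DivMod using (n%ℕd<d; a≡a%ℕn+[a/ℕn]*n)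
open import Data.Integer.Divisibility.Signed using (_∣_; divides)
open import Data.Integer.Tactic.RingSolver using (solve-∀)
open import Data.Integer.Solver using (module +-*-Solver)
open import Data.Nat as ℕ using (ℕ; NonZero; _≡ᵇ_; s≤s)
open import Data.Product using (Σ-syntax; _×_; _,_)
open import Data.Sum using (_⊎_; inj₁; inj₂)
open import Relation.Binary.PropositionalEquality
  using (_≡_; refl; sym; trans; cong; cong₂; subst; module ≡-Reasoning)

open +-*-Solver using (solve; _:+_; _:*_; _:-_; :-_; _:^_; con; _:=_)

BalancedFourSquares : ℤ → Set
BalancedFourSquares m = Σ[ x ∈ ℤ ] Σ[ y ∈ ℤ ] Σ[ z ∈ ℤ ] Σ[ w ∈ ℤ ]
  ((m ≡ x ^ 2 + y ^ 2 + z ^ 2 + w ^ 2) × (x + + 2 * y + + 2 * z ≡ + 0))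

infix 4 _∣_±_
_∣_±_ : ℤ → ℤ → ℤ → Set
k ∣ u ± v = k ∣ u + v ⊎ k ∣ u - v

module _ (k : ℕ) .{{_ : NonZero k}} (a b : ℤ) where

  private
    r s : ℕ
    r = a %ℕ k
    s = b %ℕ k
    p q : ℤ
    p = a /ℕ k
    q = b /ℕ k

  %ℕ-≡⇒∣- : r ≡ s → + k ∣ a - b
  %ℕ-≡⇒∣- r≡s = divides (p - q) (begin
    a - b                             ≡⟨ cong₂ _-_ (a≡a%ℕn+[a/ℕn]*n a k) (a≡a%ℕn+[a/ℕn]*n b k) ⟩
    (+ r + p * + k) - (+ s + q * + k) ≡⟨ cong (λ t → (+ t + p * + k) - (+ s + q * + k)) r≡s ⟩
    (+ s + p * + k) - (+ s + q * + k) ≡⟨ cancel (+ s) p q (+ k) ⟩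
    (p - q) * + k                     ∎)
    where
    open ≡-Reasoning
    cancel : ∀ s p q k → (s + p * k) - (s + q * k) ≡ (p - q) * k
    cancel = solve-∀

  %ℕ-+≡⇒∣+ : r ℕ.+ s ≡ k → + k ∣ a + b
  %ℕ-+≡⇒∣+ r+s≡k = divides (p + q + + 1) (begin
    a + b                             ≡⟨ cong₂ _+_ (a≡a%ℕn+[a/ℕn]*n a k) (a≡a%ℕn+[a/ℕn]*n b k) ⟩
    (+ r + p * + k) + (+ s + q * + k) ≡⟨ regroup (+ r) (+ s) p q (+ k) ⟩
    + (r ℕ.+ s) + (p + q) * + k       ≡⟨ cong (λ t → + t + (p + q) * + k) r+s≡k ⟩
    + k + (p + q) * + k               ≡⟨ collect p q (+ k) ⟩
    (p + q + + 1) * + k               ∎)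
    where
    open ≡-Reasoning
    regroup : ∀ r s p q k → (r + p * k) + (s + q * k) ≡ (r + s) + (p + q) * k
    regroup = solve-∀
    collect : ∀ p q k → k + (p + q) * k ≡ (p + q + + 1) * k
    collect = solve-∀

isMultipleOf3 : ℤ → Bool
isMultipleOf3 a = a %ℕ 3 ≡ᵇ 0

same-isMultipleOf3⇒3∣± : ∀ a b → isMultipleOf3 a ≡ isMultipleOf3 b → + 3 ∣ a ± b
same-isMultipleOf3⇒3∣± a b same
  with a %ℕ 3 in ra | b %ℕ 3 in rb | n%ℕd<d a 3 | n%ℕd<d b 3
... | 0 | 0 | _ | _ = inj₂ (%ℕ-≡⇒∣- 3 a b (trans ra (sym rb)))
... | 1 | 1 | _ | _ = inj₂ (%ℕ-≡⇒∣- 3 a b (trans ra (sym rb)))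
... | 2 | 2 | _ | _ = inj₂ (%ℕ-≡⇒∣- 3 a b (trans ra (sym rb)))
... | 1 | 2 | _ | _ = inj₁ (%ℕ-+≡⇒∣+ 3 a b (cong₂ ℕ._+_ ra rb))
... | 2 | 1 | _ | _ = inj₁ (%ℕ-+≡⇒∣+ 3 a b (cong₂ ℕ._+_ ra rb))
... | 0 | ℕ.suc _ | _ | _ with () ← same
... | ℕ.suc _ | 0 | _ | _ with () ← same
... | ℕ.suc (ℕ.suc (ℕ.suc _)) | _ | s≤s (s≤s (s≤s ())) | _
... | _ | ℕ.suc (ℕ.suc (ℕ.suc _)) | _ | s≤s (s≤s (s≤s ()))

Bool-pigeonhole : (x y z : Bool) → x ≡ y ⊎ x ≡ z ⊎ y ≡ z
Bool-pigeonhole false false _     = inj₁ refl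
Bool-pigeonhole true  true  _     = inj₁ refl
Bool-pigeonhole false true  false = inj₂ (inj₁ refl)
Bool-pigeonhole true  false true  = inj₂ (inj₁ refl)
Bool-pigeonhole false true  true  = inj₂ (inj₂ refl)
Bool-pigeonhole true  false false = inj₂ (inj₂ refl)

3∣±-pigeonhole : ∀ a b c → + 3 ∣ a ± b ⊎ + 3 ∣ a ± c ⊎ + 3 ∣ b ± c
3∣±-pigeonhole a b c with Bool-pigeonhole (isMultipleOf3 a) (isMultipleOf3 b) (isMultipleOf3 c)
... | inj₁ ab        = inj₁ (same-isMultipleOf3⇒3∣± a b ab)
... | inj₂ (inj₁ ac) = inj₂ (inj₁ (same-isMultipleOf3⇒3∣± a c ac))
... | inj₂ (inj₂ bc) = inj₂ (inj₂ (same-isMultipleOf3⇒3∣± b c bc))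

two-squares-as-three : ∀ s v →
  (s * + 3 - v) ^ 2 + v ^ 2 ≡ (- (+ 2 * s)) ^ 2 + (+ 2 * s - v) ^ 2 + (v - s) ^ 2
two-squares-as-three = solve 2 (λ s v →
  (s :* con (+ 3) :- v) :^ 2 :+ v :^ 2
    := (:- (con (+ 2) :* s)) :^ 2 :+ (con (+ 2) :* s :- v) :^ 2 :+ (v :- s) :^ 2) refl

two-squares-as-three-balanced : ∀ s v → - (+ 2 * s) + + 2 * (+ 2 * s - v) + + 2 * (v - s) ≡ + 0
two-squares-as-three-balanced = solve-∀

balanced-3s-v : ∀ s v w → BalancedFourSquares ((s * + 3 - v) ^ 2 + v ^ 2 + w ^ 2)
balanced-3s-v s v w =
  - (+ 2 * s) , + 2 * s - v , v - s , w ,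
  cong (_+ w ^ 2) (two-squares-as-three s v) , two-squares-as-three-balanced s v

3∣+⇒balanced : ∀ u v w → + 3 ∣ u + v → BalancedFourSquares (u ^ 2 + v ^ 2 + w ^ 2)
3∣+⇒balanced u v w (divides s u+v≡s*3) =
  subst (λ t → BalancedFourSquares (t ^ 2 + v ^ 2 + w ^ 2)) (sym u≡s*3-v)
        (balanced-3s-v s v w)
  where
  add-sub : ∀ i j → i ≡ i + j - j
  add-sub = solve-∀
  u≡s*3-v : u ≡ s * + 3 - v
  u≡s*3-v = trans (add-sub u v) (cong (_- v) u+v≡s*3)

3∣±⇒balanced : ∀ u v w → + 3 ∣ u ± v → BalancedFourSquares (u ^ 2 + v ^ 2 + w ^ 2)
3∣±⇒balanced u v w (inj₁ 3∣u+v) = 3∣+⇒balanced u v w 3∣u+v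
3∣±⇒balanced u v w (inj₂ 3∣u-v) =
  subst (λ t → BalancedFourSquares (u ^ 2 + t + w ^ 2)) (square-neg v)
        (3∣+⇒balanced u (- v) w 3∣u-v)
  where
  square-neg : ∀ t → (- t) ^ 2 ≡ t ^ 2
  square-neg = solve 1 (λ t → (:- t) :^ 2 := t :^ 2) refl

balanced-sum-of-three-squares : ∀ a b c → BalancedFourSquares (a ^ 2 + b ^ 2 + c ^ 2)
balanced-sum-of-three-squares a b c with 3∣±-pigeonhole a b c
... | inj₁ 3∣a±b        = 3∣±⇒balanced a b c 3∣a±b
... | inj₂ (inj₁ 3∣a±c) =
  subst BalancedFourSquares (swap-last (a ^ 2) (b ^ 2) (c ^ 2)) (3∣±⇒balanced a c b 3∣a±c)
  where
  swap-last : ∀ x y z → x + z + y ≡ x + y + z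
  swap-last = solve-∀
... | inj₂ (inj₂ 3∣b±c) =
  subst BalancedFourSquares (rotate (a ^ 2) (b ^ 2) (c ^ 2)) (3∣±⇒balanced b c a 3∣b±c)
  where
  rotate : ∀ x y z → y + z + x ≡ x + y + z
  rotate = solve-∀

lemma2p1 : (n : ℕ) →
    Σ[ a ∈ ℤ ] Σ[ b ∈ ℤ ] Σ[ c ∈ ℤ ] (+ n ≡ a ^ 2 + b ^ 2 + c ^ 2) →
    Σ[ x ∈ ℤ ] Σ[ y ∈ ℤ ] Σ[ z ∈ ℤ ] Σ[ w ∈ ℤ ]
      ((+ n ≡ x ^ 2 + y ^ 2 + z ^ 2 + w ^ 2) × (x + + 2 * y + + 2 * z ≡ + 0))
lemma2p1 n (a , b , c , n≡a²+b²+c²) =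
  subst BalancedFourSquares (sym n≡a²+b²+c²) (balanced-sum-of-three-squares a b c)
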